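{- For every $n\in\mathbb{N}$, the ARS $\mathcal{A}_n$ (defined below) belongs to $\mathrm{DC}_{5n+1}$.
   Context: ARSs with two relations $(A,\to,\leadsto)$. Construction: $\mathcal{A}_0$ has elements $s_0,a_2,a_3,c,b_2,b_3,t_0$ and steps $s_0\to a_2$, $s_0\leadsto a_3$, $a_2\to c$, $a_2\leadsto c$, $a_3\to c$, $a_3\leadsto c$, $t_0\leadsto b_2$, $t_0\to b_3$, $b_2\to c$, $b_2\leadsto c$, $b_3\to c$, $b_3\leadsto c$. Given $\mathcal{A}_n$ with distinguished elements $s_n,t_n$, $\mathcal{A}_{n+1}$ is obtained by adding 14 fresh elements $x_1,\dots,x_7,y_1,\dots,y_7$ and the steps $x_1\leadsto x_2\leadsto x_4\leadsto x_5\leadsto x_7\leadsto s_n$, $x_1\to x_3\to x_4\to x_6\to x_7\to t_n$, $x_3\leadsto x_6\leadsto t_n$, $x_2\to x_5\to s_n$, $y_1\to y_2\to y_4\to y_5\to y_7\to s_n$, $y_1\leadsto y_3\leadsto y_4\leadsto y_6\leadsto y_7\leadsto t_n$, $y_3\to y_6\to t_n$, $y_2\leadsto y_5\leadsto s_n$; set $s_{n+1}=x_1$, $t_{n+1}=y_1$. For an ordinal $\alpha$, $(A,\to,\leadsto)\in\mathrm{DC}_\alpha$ if there are families $(\to_\gamma)_{\gamma<\alpha}$, $(\leadsto_\gamma)_{\gamma<\alpha}$ with unions $\to$ and $\leadsto$ respectively such that for every peak $a\to_\beta c$, $a\leadsto_\gamma b$ there is $d$ with $b \twoheadrightarrow_{<\gamma}\cdot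 \to^{\equiv}_{\beta}\cdot \twoheadrightarrow_{<\gamma\cup<\beta} d$ and $c \leadsto^*_{<\beta}\cdot \leadsto^{\equiv}_{\gamma}\cdot \leadsto^*_{<\gamma\cup<\beta} d$, where ${\to_{<\delta}}=\bigcup_{\epsilon<\delta}{\to_\epsilon}$, ${\to_{<\gamma\cup<\beta}}={\to_{<\gamma}}\cup{\to_{<\beta}}$ (likewise for $\leadsto$), $\twoheadrightarrow_X,\leadsto^*_X$ are reflexive transitive closures and $R^\equiv$ is $R$ union identity. -}

module Defs where

open import Level using (0ℓ)
open import Data.Nat using (ℕ; zero; suc; _<_)
open import Data.Sum using (_⊎_; inj₁; inj₂)
open import Data.Product using (Σ; ∃; ∃-syntax; _×_; _,_)
open import Function.Bundles using (_⇔_)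
open import Relation.Binary.Core using (Rel)
open import Relation.Binary.Construct.Closure.ReflexiveTransitive using (Star)
open import Relation.Binary.Construct.Closure.Reflexive using (ReflClosure)
open import Relation.Binary.Construct.Union using (_∪_)

record ARS₂ : Set₁ where
  field
    Carrier : Set
    _⟶_     : Rel Carrier 0ℓ
    _⇝_     : Rel Carrier 0ℓ

-- Labelled families and DC_α, for a finite ordinal α (a natural number).
-- Labels are natural numbers; only labels γ < α are used.

infixr 9 _⨾_
_⨾_ : {A : Set} → Rel A 0ℓ → Rel A 0ℓ → Rel A 0ℓ
(R ⨾ S) a c = ∃[ b ] (R a b × S b c)

Below : {A : Set} → (ℕ → Rel A 0ℓ) → ℕ → Rel A 0ℓ
Below R δ a b = ∃[ ε ] (ε < δ × R ε a b)

UnionIs : {A : Set} → ℕ → (ℕ → Rel A 0ℓ) → Rel A 0ℓ → Set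
UnionIs α R S = ∀ a b → (S a b ⇔ (∃[ γ ] (γ < α × R γ a b)))

PeakJoin : {A : Set} → (F G : ℕ → Rel A 0ℓ) → ℕ → ℕ → A → A → Set
PeakJoin F G β γ b c =
  ∃[ d ] ( (Star (Below F γ) ⨾ ReflClosure (F β) ⨾ Star (Below F γ ∪ Below F β)) b d
         × (Star (Below G β) ⨾ ReflClosure (G γ) ⨾ Star (Below G γ ∪ Below G β)) c d )

DC : ℕ → ARS₂ → Set₁
DC α 𝒜 =
  Σ (ℕ → Rel Carrier 0ℓ) λ F →
  Σ (ℕ → Rel Carrier 0ℓ) λ G →
    UnionIs α F _⟶_ × UnionIs α G _⇝_ ×
    (∀ β γ a b c → β < α → γ < α → F β a c → G γ a b → PeakJoin F G β γ b c)
  where open ARS₂ 𝒜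

data B₀ : Set where
  s₀ a₂ a₃ c b₂ b₃ t₀ : B₀

data Fresh : Set where
  x₁ x₂ x₃ x₄ x₅ x₆ x₇ y₁ y₂ y₃ y₄ y₅ y₆ y₇ : Fresh

El : ℕ → Set
El zero = B₀
El (suc n) = Fresh ⊎ El n

sₙ : (n : ℕ) → El n
sₙ zero = s₀
sₙ (suc n) = inj₁ x₁

tₙ : (n : ℕ) → El n
tₙ zero = t₀
tₙ (suc n) = inj₁ y₁

data Arr₀ : Rel B₀ 0ℓ where
  s₀a₂ : Arr₀ s₀ a₂
  a₂c  : Arr₀ a₂ c
  a₃c  : Arr₀ a₃ c
  t₀b₃ : Arr₀ t₀ b₃
  b₂c  : Arr₀ b₂ c
  b₃c  : Arr₀ b₃ c

data Sq₀ : Rel B₀ 0ℓ where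
  s₀a₃ : Sq₀ s₀ a₃
  a₂c  : Sq₀ a₂ c
  a₃c  : Sq₀ a₃ c
  t₀b₂ : Sq₀ t₀ b₂
  b₂c  : Sq₀ b₂ c
  b₃c  : Sq₀ b₃ c

data ArrS {E : Set} (R : Rel E 0ℓ) (s t : E) : Rel (Fresh ⊎ E) 0ℓ where
  old  : ∀ {a b} → R a b → ArrS R s t (inj₂ a) (inj₂ b)
  x₁x₃ : ArrS R s t (inj₁ x₁) (inj₁ x₃)
  x₃x₄ : ArrS R s t (inj₁ x₃) (inj₁ x₄)
  x₄x₆ : ArrS R s t (inj₁ x₄) (inj₁ x₆)
  x₆x₇ : ArrS R s t (inj₁ x₆) (inj₁ x₇)
  x₇t  : ArrS R s t (inj₁ x₇) (inj₂ t)
  x₂x₅ : ArrS R s t (inj₁ x₂) (inj₁ x₅)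
  x₅s  : ArrS R s t (inj₁ x₅) (inj₂ s)
  y₁y₂ : ArrS R s t (inj₁ y₁) (inj₁ y₂)
  y₂y₄ : ArrS R s t (inj₁ y₂) (inj₁ y₄)
  y₄y₅ : ArrS R s t (inj₁ y₄) (inj₁ y₅)
  y₅y₇ : ArrS R s t (inj₁ y₅) (inj₁ y₇)
  y₇s  : ArrS R s t (inj₁ y₇) (inj₂ s)
  y₃y₆ : ArrS R s t (inj₁ y₃) (inj₁ y₆)
  y₆t  : ArrS R s t (inj₁ y₆) (inj₂ t)

data SqS {E : Set} (R : Rel E 0ℓ) (s t : E) : Rel (Fresh ⊎ E) 0ℓ where
  old  : ∀ {a b} → R a b → SqS R s t (inj₂ a) (inj₂ b)
  x₁x₂ : SqS R s t (inj₁ x₁) (inj₁ x₂)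
  x₂x₄ : SqS R s t (inj₁ x₂) (inj₁ x₄)
  x₄x₅ : SqS R s t (inj₁ x₄) (inj₁ x₅)
  x₅x₇ : SqS R s t (inj₁ x₅) (inj₁ x₇)
  x₇s  : SqS R s t (inj₁ x₇) (inj₂ s)
  x₃x₆ : SqS R s t (inj₁ x₃) (inj₁ x₆)
  x₆t  : SqS R s t (inj₁ x₆) (inj₂ t)
  y₁y₃ : SqS R s t (inj₁ y₁) (inj₁ y₃)
  y₃y₄ : SqS R s t (inj₁ y₃) (inj₁ y₄)
  y₄y₆ : SqS R s t (inj₁ y₄) (inj₁ y₆)
  y₆y₇ : SqS R s t (inj₁ y₆) (inj₁ y₇)
  y₇t  : SqS R s t (inj₁ y₇) (inj₂ t)
  y₂y₅ : SqS R s t (inj₁ y₂) (inj₁ y₅)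
  y₅s  : SqS R s t (inj₁ y₅) (inj₂ s)

Arr : (n : ℕ) → Rel (El n) 0ℓ
Arr zero = Arr₀
Arr (suc n) = ArrS (Arr n) (sₙ n) (tₙ n)

Sq : (n : ℕ) → Rel (El n) 0ℓ
Sq zero = Sq₀
Sq (suc n) = SqS (Sq n) (sₙ n) (tₙ n)

𝒜 : ℕ → ARS₂
𝒜 n = record { Carrier = El n ; _⟶_ = Arr n ; _⇝_ = Sq n }

module Submission where

open import Defs
open import Data.Nat using (ℕ; zero; suc; _+_; _*_; _<_; _≤_; s≤s; z≤n)
open import Data.Nat.Properties using (≤-refl; ≤-reflexive; ≤-trans; <-trans; <-≤-trans; n≤1+n; *-suc; +-monoˡ-≤)
open import Data.Sum using (inj₁; inj₂)
import Data.Sum as Sum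
open import Data.Product using (Σ; _,_)
open import Function.Bundles using (mk⇔)
open import Level using (0ℓ)
open import Relation.Binary.Core using (Rel; _=[_]⇒_)
open import Relation.Binary.PropositionalEquality using (_≡_; refl; sym; cong)
open import Relation.Binary.Construct.Closure.ReflexiveTransitive using (Star; ε; _◅_)
import Relation.Binary.Construct.Closure.ReflexiveTransitive as Star
open import Relation.Binary.Construct.Closure.Reflexive using (ReflClosure; [_]) renaming (refl to rfl)
import Relation.Binary.Construct.Closure.Reflexive as ReflClosure

-- Label the steps of 𝒜ₙ₊₁ inherited from 𝒜ₙ as in 𝒜ₙ, and the new ones with just two
-- fresh labels r n < r n + 1 above all old labels. A peak of new steps is closed
-- by following new steps down to sₙ or tₙ and finishing inside 𝒜ₙ, where all labels are
-- below r n and sₙ, tₙ have common reducts sₙ ↠ · ⇜* tₙ and tₙ ↠ · ⇜* sₙ; peaks of old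
-- steps are joined as in 𝒜ₙ. Hence 𝒜ₙ ∈ DC (r n) for any r with r 0 ≥ 1 and
-- r (n + 1) ≥ r n + 2, in particular for r n = 5 n + 1.

LabelledBy : {A : Set} (R : Rel A 0ℓ) → (∀ {a b} → R a b → ℕ) → ℕ → Rel A 0ℓ
LabelledBy R label β a b = Σ (R a b) λ p → label p ≡ β

module _ (𝒜 : ARS₂) (α : ℕ) where
  open ARS₂ 𝒜

  DC-fromLabels :
    (label⟶ : ∀ {a b} → a ⟶ b → ℕ) (label⇝ : ∀ {a b} → a ⇝ b → ℕ) →
    (∀ {a b} (p : a ⟶ b) → label⟶ p < α) → (∀ {a b} (q : a ⇝ b) → label⇝ q < α) →
    (∀ {a b c} (p : a ⟶ c) (q : a ⇝ b) →
       PeakJoin (LabelledBy _⟶_ label⟶) (LabelledBy _⇝_ label⇝) (label⟶ p) (label⇝ q) b c) →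
    DC α 𝒜
  DC-fromLabels label⟶ label⇝ bound⟶ bound⇝ join =
    LabelledBy _⟶_ label⟶ , LabelledBy _⇝_ label⇝ ,
    (λ a b → mk⇔ (λ p → label⟶ p , bound⟶ p , (p , refl)) (λ { (_ , _ , p , _) → p })) ,
    (λ a b → mk⇔ (λ q → label⇝ q , bound⇝ q , (q , refl)) (λ { (_ , _ , q , _) → q })) ,
    λ { _ _ _ _ _ _ _ (p , refl) (q , refl) → join p q }

module _ {A B : Set} (f : A → B) where

  Below-map : {F : ℕ → Rel A 0ℓ} {F′ : ℕ → Rel B 0ℓ} →
              (∀ {β} → F β =[ f ]⇒ F′ β) → ∀ {δ} → Below F δ =[ f ]⇒ Below F′ δ
  Below-map F⇒F′ (ℓ , ℓ<δ , p) = ℓ , ℓ<δ , F⇒F′ p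

  PeakJoin-map : {F G : ℕ → Rel A 0ℓ} {F′ G′ : ℕ → Rel B 0ℓ} →
                 (∀ {β} → F β =[ f ]⇒ F′ β) → (∀ {γ} → G γ =[ f ]⇒ G′ γ) →
                 ∀ {β γ b c} → PeakJoin F G β γ b c → PeakJoin F′ G′ β γ (f b) (f c)
  PeakJoin-map {F} {G} {F′} {G′} F⇒F′ G⇒G′ (d , (_ , b↠ , _ , b→ , ↠d) , (_ , c⇝ , _ , c⇝′ , ⇝d)) =
    f d ,
    (_ , Star.gmap f belowF b↠ , _ , ReflClosure.map F⇒F′ b→ , Star.gmap f (Sum.map belowF belowF) ↠d) ,
    (_ , Star.gmap f belowG c⇝ , _ , ReflClosure.map G⇒G′ c⇝′ , Star.gmap f (Sum.map belowG belowG) ⇝d)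
    where
    belowF : ∀ {δ} → Below F δ =[ f ]⇒ Below F′ δ
    belowF = Below-map {F} {F′} F⇒F′
    belowG : ∀ {δ} → Below G δ =[ f ]⇒ Below G′ δ
    belowG = Below-map {G} {G′} G⇒G′

chain : {A : Set} {X Y Z : Rel A 0ℓ} {b e f d : A} →
        Star X b e → ReflClosure Y e f → Star Z f d → (Star X ⨾ ReflClosure Y ⨾ Star Z) b d
chain b↠e e→f f↠d = _ , b↠e , _ , e→f , f↠d

meetˢᵗ : ∀ n → El n
meetˢᵗ zero = c
meetˢᵗ (suc n) = inj₂ (tₙ n)

sₙ↠meetˢᵗ : ∀ n → Star (Arr n) (sₙ n) (meetˢᵗ n)
sₙ↠meetˢᵗ zero = s₀a₂ ◅ a₂c ◅ ε
sₙ↠meetˢᵗ (suc n) = x₁x₃ ◅ x₃x₄ ◅ x₄x₆ ◅ x₆x₇ ◅ x₇t ◅ ε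

tₙ⇝*meetˢᵗ : ∀ n → Star (Sq n) (tₙ n) (meetˢᵗ n)
tₙ⇝*meetˢᵗ zero = t₀b₂ ◅ b₂c ◅ ε
tₙ⇝*meetˢᵗ (suc n) = y₁y₃ ◅ y₃y₄ ◅ y₄y₆ ◅ y₆y₇ ◅ y₇t ◅ ε

meetᵗˢ : ∀ n → El n
meetᵗˢ zero = c
meetᵗˢ (suc n) = inj₂ (sₙ n)

tₙ↠meetᵗˢ : ∀ n → Star (Arr n) (tₙ n) (meetᵗˢ n)
tₙ↠meetᵗˢ zero = t₀b₃ ◅ b₃c ◅ ε
tₙ↠meetᵗˢ (suc n) = y₁y₂ ◅ y₂y₄ ◅ y₄y₅ ◅ y₅y₇ ◅ y₇s ◅ ε

sₙ⇝*meetᵗˢ : ∀ n → Star (Sq n) (sₙ n) (meetᵗˢ n)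
sₙ⇝*meetᵗˢ zero = s₀a₃ ◅ a₃c ◅ ε
sₙ⇝*meetᵗˢ (suc n) = x₁x₂ ◅ x₂x₄ ◅ x₄x₅ ◅ x₅x₇ ◅ x₇s ◅ ε

module Ranked (r : ℕ → ℕ) (r-pos : 0 < r 0) (r-gap : ∀ n → 2 + r n ≤ r (suc n)) where

  arrLabel : ∀ n {a b} → Arr n a b → ℕ
  arrLabel zero _ = 0
  arrLabel (suc n) (old p) = arrLabel n p
  arrLabel (suc n) y₁y₂ = suc (r n)
  arrLabel (suc n) y₂y₄ = suc (r n)
  arrLabel (suc n) y₃y₆ = suc (r n)
  arrLabel (suc n) _ = r n

  sqLabel : ∀ n {a b} → Sq n a b → ℕ
  sqLabel zero _ = 0
  sqLabel (suc n) (old q) = sqLabel n q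
  sqLabel (suc n) x₁x₂ = suc (r n)
  sqLabel (suc n) x₂x₄ = suc (r n)
  sqLabel (suc n) x₃x₆ = suc (r n)
  sqLabel (suc n) _ = r n

  F G : ∀ n → ℕ → Rel (El n) 0ℓ
  F n = LabelledBy (Arr n) (arrLabel n)
  G n = LabelledBy (Sq n) (sqLabel n)

  r<r-suc : ∀ n → r n < r (suc n)
  r<r-suc n = ≤-trans (n≤1+n _) (r-gap n)

  arrLabel< : ∀ n {a b} (p : Arr n a b) → arrLabel n p < r n
  arrLabel< zero _ = r-pos
  arrLabel< (suc n) (old p) = <-trans (arrLabel< n p) (r<r-suc n)
  arrLabel< (suc n) y₁y₂ = r-gap n
  arrLabel< (suc n) y₂y₄ = r-gap n
  arrLabel< (suc n) y₃y₆ = r-gap n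
  arrLabel< (suc n) x₁x₃ = r<r-suc n
  arrLabel< (suc n) x₃x₄ = r<r-suc n
  arrLabel< (suc n) x₄x₆ = r<r-suc n
  arrLabel< (suc n) x₆x₇ = r<r-suc n
  arrLabel< (suc n) x₇t = r<r-suc n
  arrLabel< (suc n) x₂x₅ = r<r-suc n
  arrLabel< (suc n) x₅s = r<r-suc n
  arrLabel< (suc n) y₄y₅ = r<r-suc n
  arrLabel< (suc n) y₅y₇ = r<r-suc n
  arrLabel< (suc n) y₇s = r<r-suc n
  arrLabel< (suc n) y₆t = r<r-suc n

  sqLabel< : ∀ n {a b} (q : Sq n a b) → sqLabel n q < r n
  sqLabel< zero _ = r-pos
  sqLabel< (suc n) (old q) = <-trans (sqLabel< n q) (r<r-suc n)
  sqLabel< (suc n) x₁x₂ = r-gap n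
  sqLabel< (suc n) x₂x₄ = r-gap n
  sqLabel< (suc n) x₃x₆ = r-gap n
  sqLabel< (suc n) x₄x₅ = r<r-suc n
  sqLabel< (suc n) x₅x₇ = r<r-suc n
  sqLabel< (suc n) x₇s = r<r-suc n
  sqLabel< (suc n) x₆t = r<r-suc n
  sqLabel< (suc n) y₁y₃ = r<r-suc n
  sqLabel< (suc n) y₃y₄ = r<r-suc n
  sqLabel< (suc n) y₄y₆ = r<r-suc n
  sqLabel< (suc n) y₆y₇ = r<r-suc n
  sqLabel< (suc n) y₇t = r<r-suc n
  sqLabel< (suc n) y₂y₅ = r<r-suc n
  sqLabel< (suc n) y₅s = r<r-suc n

  old↠ : ∀ {n γ a b} → r n ≤ γ → Star (Arr n) a b → Star (Below (F (suc n)) γ) (inj₂ a) (inj₂ b)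
  old↠ {n} r≤γ = Star.gmap inj₂ λ p → arrLabel n p , <-≤-trans (arrLabel< n p) r≤γ , old p , refl

  old⇝* : ∀ {n γ a b} → r n ≤ γ → Star (Sq n) a b → Star (Below (G (suc n)) γ) (inj₂ a) (inj₂ b)
  old⇝* {n} r≤γ = Star.gmap inj₂ λ q → sqLabel n q , <-≤-trans (sqLabel< n q) r≤γ , old q , refl

  new→ : ∀ {n a b} (p : Arr (suc n) a b) → Below (F (suc n)) (suc (arrLabel (suc n) p)) a b
  new→ p = _ , ≤-refl , p , refl

  new⇝ : ∀ {n a b} (q : Sq (suc n) a b) → Below (G (suc n)) (suc (sqLabel (suc n) q)) a b
  new⇝ q = _ , ≤-refl , q , refl

  peak : ∀ n {a b c} (p : Arr n a c) (q : Sq n a b) → PeakJoin (F n) (G n) (arrLabel n p) (sqLabel n q) b c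
  peak zero s₀a₂ s₀a₃ = c , chain ε [ a₃c , refl ] ε , chain ε [ a₂c , refl ] ε
  peak zero t₀b₃ t₀b₂ = c , chain ε [ b₂c , refl ] ε , chain ε [ b₃c , refl ] ε
  peak zero a₂c a₂c = c , chain ε rfl ε , chain ε rfl ε
  peak zero a₃c a₃c = c , chain ε rfl ε , chain ε rfl ε
  peak zero b₂c b₂c = c , chain ε rfl ε , chain ε rfl ε
  peak zero b₃c b₃c = c , chain ε rfl ε , chain ε rfl ε
  peak (suc n) (old p) (old q) =
    PeakJoin-map inj₂ {F n} {G n} {F (suc n)} {G (suc n)}
      (λ { (p′ , e) → old p′ , e }) (λ { (q′ , e) → old q′ , e }) (peak n p q)
  peak (suc n) x₁x₃ x₁x₂ = inj₂ (meetˢᵗ n) ,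
    chain (new→ x₂x₅ ◅ new→ x₅s ◅ old↠ (n≤1+n _) (sₙ↠meetˢᵗ n)) rfl ε ,
    chain ε [ x₃x₆ , refl ] (inj₁ (new⇝ x₆t) ◅ Star.map inj₂ (old⇝* ≤-refl (tₙ⇝*meetˢᵗ n)))
  peak (suc n) x₃x₄ x₃x₆ = inj₁ x₇ ,
    chain (new→ x₆x₇ ◅ ε) rfl ε ,
    chain ε rfl (inj₁ (new⇝ x₄x₅) ◅ inj₁ (new⇝ x₅x₇) ◅ ε)
  peak (suc n) x₄x₆ x₄x₅ = inj₂ (meetˢᵗ n) ,
    chain ε [ x₅s , refl ] (Star.map inj₁ (old↠ ≤-refl (sₙ↠meetˢᵗ n))) ,
    chain ε [ x₆t , refl ] (Star.map inj₂ (old⇝* ≤-refl (tₙ⇝*meetˢᵗ n)))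
  peak (suc n) x₆x₇ x₆t = inj₂ (meetᵗˢ n) ,
    chain (old↠ ≤-refl (tₙ↠meetᵗˢ n)) rfl ε ,
    chain ε [ x₇s , refl ] (Star.map inj₂ (old⇝* ≤-refl (sₙ⇝*meetᵗˢ n)))
  peak (suc n) x₇t x₇s = inj₂ (meetˢᵗ n) ,
    chain (old↠ ≤-refl (sₙ↠meetˢᵗ n)) rfl ε ,
    chain (old⇝* ≤-refl (tₙ⇝*meetˢᵗ n)) rfl ε
  peak (suc n) x₂x₅ x₂x₄ = inj₁ x₇ ,
    chain (new→ x₄x₆ ◅ new→ x₆x₇ ◅ ε) rfl ε ,
    chain ε rfl (inj₁ (new⇝ x₅x₇) ◅ ε)
  peak (suc n) x₅s x₅x₇ = inj₂ (meetᵗˢ n) ,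
    chain ε [ x₇t , refl ] (Star.map inj₁ (old↠ ≤-refl (tₙ↠meetᵗˢ n))) ,
    chain (old⇝* ≤-refl (sₙ⇝*meetᵗˢ n)) rfl ε
  peak (suc n) y₁y₂ y₁y₃ = inj₂ (meetᵗˢ n) ,
    chain ε [ y₃y₆ , refl ] (inj₂ (new→ y₆t) ◅ Star.map inj₁ (old↠ ≤-refl (tₙ↠meetᵗˢ n))) ,
    chain (new⇝ y₂y₅ ◅ new⇝ y₅s ◅ old⇝* (n≤1+n _) (sₙ⇝*meetᵗˢ n)) rfl ε
  peak (suc n) y₂y₄ y₂y₅ = inj₁ y₇ ,
    chain ε rfl (inj₂ (new→ y₅y₇) ◅ ε) ,
    chain (new⇝ y₄y₆ ◅ new⇝ y₆y₇ ◅ ε) rfl ε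
  peak (suc n) y₄y₅ y₄y₆ = inj₂ (meetᵗˢ n) ,
    chain ε [ y₆t , refl ] (Star.map inj₁ (old↠ ≤-refl (tₙ↠meetᵗˢ n))) ,
    chain ε [ y₅s , refl ] (Star.map inj₂ (old⇝* ≤-refl (sₙ⇝*meetᵗˢ n)))
  peak (suc n) y₅y₇ y₅s = inj₂ (meetˢᵗ n) ,
    chain (old↠ ≤-refl (sₙ↠meetˢᵗ n)) rfl ε ,
    chain ε [ y₇t , refl ] (Star.map inj₂ (old⇝* ≤-refl (tₙ⇝*meetˢᵗ n)))
  peak (suc n) y₇s y₇t = inj₂ (meetᵗˢ n) ,
    chain (old↠ ≤-refl (tₙ↠meetᵗˢ n)) rfl ε ,
    chain (old⇝* ≤-refl (sₙ⇝*meetᵗˢ n)) rfl ε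
  peak (suc n) y₃y₆ y₃y₄ = inj₁ y₇ ,
    chain ε rfl (inj₂ (new→ y₄y₅) ◅ inj₂ (new→ y₅y₇) ◅ ε) ,
    chain (new⇝ y₆y₇ ◅ ε) rfl ε
  peak (suc n) y₆t y₆y₇ = inj₂ (meetˢᵗ n) ,
    chain ε [ y₇s , refl ] (Star.map inj₁ (old↠ ≤-refl (sₙ↠meetˢᵗ n))) ,
    chain (old⇝* ≤-refl (tₙ⇝*meetˢᵗ n)) rfl ε

  𝒜∈DC : ∀ n → DC (r n) (𝒜 n)
  𝒜∈DC n = DC-fromLabels (𝒜 n) (r n) (arrLabel n) (sqLabel n) (arrLabel< n) (sqLabel< n) (peak n)

lemma5p6 : (n : ℕ) → DC (5 * n + 1) (𝒜 n)
lemma5p6 = Ranked.𝒜∈DC (λ n → 5 * n + 1) (s≤s z≤n) gap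
  where
  gap : ∀ n → 2 + (5 * n + 1) ≤ 5 * suc n + 1
  gap n = ≤-trans (+-monoˡ-≤ (5 * n + 1) (s≤s (s≤s (z≤n {3}))))
                  (≤-reflexive (cong (_+ 1) (sym (*-suc 5 n))))
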